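{- Let $\mathfrak P,\mathfrak P_1,\mathfrak P_2$ be well-founded upwards linear partial orders. If $\mathfrak P$ is a box-augmentation of $(\mathfrak P_1,\mathfrak P_2)$, then $\mathfrak P_1$ or $\mathfrak P_2$ does not contain a branching node.
   Context: A partial order is upwards linear if for every $p$ the set $\{a\mid p<a\}$ is linearly ordered; well-founded means no infinite strictly descending chain. An element $a$ of a partial order is a branching node if there are $b,c$ with $b<a$, $c<a$ and $b,c$ incomparable. $\mathfrak P$ is a box-augmentation of $(\mathfrak P_1,\mathfrak P_2)$ if there is a bijection $\eta:P_1\times P_2\to P$ such that for each fixed $d_2\in P_2$ the map $e\mapsto\eta(e,d_2)$ is an order embedding of $\mathfrak P_1$ into $\mathfrak P$, and for each fixed $d_1\in P_1$ the map $e\mapsto\eta(d_1,e)$ is an order embedding of $\mathfrak P_2$ into $\mathfrak P$. -}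

module Defs where

open import Level using (Level; _⊔_; suc)
open import Data.Nat using (ℕ) renaming (suc to sucℕ)
open import Data.Product using (Σ; ∃; _×_; _,_)
open import Relation.Nullary using (¬_)
open import Relation.Binary.PropositionalEquality using (_≡_)
open import Function.Definitions using (Bijective)

-- A (strict) partial order on a type, equality being propositional equality.
-- a ≤ b is read as a < b ⊎ a ≡ b.
record Poset (ℓ : Level) : Set (suc ℓ) where
  field
    Carrier : Set ℓ
    _<_     : Carrier → Carrier → Set ℓ
    irrefl  : ∀ {a} → ¬ (a < a)
    trans   : ∀ {a b c} → a < b → b < c → a < c

module _ {ℓ : Level} (𝔓 : Poset ℓ) where
  open Poset 𝔓

  Incomparable : Carrier → Carrier → Set ℓ
  Incomparable b c = ¬ (b ≡ c) × ¬ (b < c) × ¬ (c < b)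

  UpwardsLinear : Set ℓ
  UpwardsLinear = ∀ {p a b} → p < a → p < b → ¬ Incomparable a b

  WellFounded : Set ℓ
  WellFounded = ¬ (Σ (ℕ → Carrier) λ f → ∀ n → f (sucℕ n) < f n)

  IsBranchingNode : Carrier → Set ℓ
  IsBranchingNode a = Σ Carrier λ b → Σ Carrier λ c → b < a × c < a × Incomparable b c

  HasBranchingNode : Set ℓ
  HasBranchingNode = Σ Carrier IsBranchingNode

IsOrderEmbedding : ∀ {ℓ} (𝔓 𝔔 : Poset ℓ) → (Poset.Carrier 𝔓 → Poset.Carrier 𝔔) → Set ℓ
IsOrderEmbedding 𝔓 𝔔 f =
  (∀ x y → f x ≡ f y → x ≡ y) ×
  ∀ x y → (Poset._<_ 𝔓 x y → Poset._<_ 𝔔 (f x) (f y)) × (Poset._<_ 𝔔 (f x) (f y) → Poset._<_ 𝔓 x y)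

IsBoxAugmentation : ∀ {ℓ} (𝔓 𝔓₁ 𝔓₂ : Poset ℓ) → Set ℓ
IsBoxAugmentation 𝔓 𝔓₁ 𝔓₂ =
  Σ (Poset.Carrier 𝔓₁ × Poset.Carrier 𝔓₂ → Poset.Carrier 𝔓) λ η →
      Bijective _≡_ _≡_ η
    × (∀ d₂ → IsOrderEmbedding 𝔓₁ 𝔓 (λ e → η (e , d₂)))
    × (∀ d₁ → IsOrderEmbedding 𝔓₂ 𝔓 (λ e → η (d₁ , e)))

-- Take branching nodes a ∈ 𝔓₁ over incomparable b₁, c₁ and a′ ∈ 𝔓₂ over
-- incomparable b₂, c₂. For x₁ < y₁ and x₂ < y₂ the corners η (x₁ , y₂) and
-- η (y₁ , x₂) both lie above η (x₁ , x₂), so by upwards linearity of 𝔓 they are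
-- comparable. But in an upwards linear order incomparability is inherited
-- downwards, so from η (b₁ , a′) ⊥ η (c₁ , a′), η (a , b₂) ⊥ η (a , c₂) and the
-- comparability of the corner pairs (b₁ , c₂) and (c₁ , b₂) one gets
-- η (b₁ , a′) ⊥ η (a , b₂), contradicting the corner pair (b₁ , b₂).
module Submission where

open import Defs
open import Level using (Level)
open import Data.Product using (_×_; _,_; proj₁; proj₂)
open import Relation.Nullary using (¬_)
open import Relation.Binary.PropositionalEquality using (refl; sym)

module _ {ℓ : Level} (𝔓 : Poset ℓ) where
  open Poset 𝔓

  incomparable-sym : ∀ {x y} → Incomparable 𝔓 x y → Incomparable 𝔓 y x
  incomparable-sym (x≢y , x≮y , y≮x) = (λ y≡x → x≢y (sym y≡x)) , y≮x , x≮y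

  incomparable-downwards : UpwardsLinear 𝔓 → ∀ {x y z} →
    x < y → Incomparable 𝔓 y z → Incomparable 𝔓 x z
  incomparable-downwards ul x<y y⊥z@(_ , _ , z≮y) =
    (λ { refl → z≮y x<y }) , (λ x<z → ul x<y x<z y⊥z) , (λ z<x → z≮y (trans z<x x<y))

  cross-comparable⇒incomparable : UpwardsLinear 𝔓 → ∀ {u₁ u₂ v₁ v₂} →
    Incomparable 𝔓 u₁ u₂ → Incomparable 𝔓 v₁ v₂ →
    ¬ Incomparable 𝔓 u₁ v₂ → ¬ Incomparable 𝔓 u₂ v₁ →
    Incomparable 𝔓 u₁ v₁
  cross-comparable⇒incomparable ul u₁⊥u₂ v₁⊥v₂ u₁≁v₂ u₂≁v₁ =
    (λ { refl → u₁≁v₂ v₁⊥v₂ })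
    , (λ u₁<v₁ → u₁≁v₂ (incomparable-downwards ul u₁<v₁ v₁⊥v₂))
    , (λ v₁<u₁ → u₂≁v₁ (incomparable-sym (incomparable-downwards ul v₁<u₁ u₁⊥u₂)))

module _ {ℓ : Level} (𝔓 𝔔 : Poset ℓ) {f : Poset.Carrier 𝔓 → Poset.Carrier 𝔔}
         (emb : IsOrderEmbedding 𝔓 𝔔 f) where
  open Poset 𝔓 using (_<_)

  embedding-mono : ∀ {x y} → x < y → Poset._<_ 𝔔 (f x) (f y)
  embedding-mono = proj₁ (proj₂ emb _ _)

  embedding-incomparable : ∀ {x y} → Incomparable 𝔓 x y → Incomparable 𝔔 (f x) (f y)
  embedding-incomparable (x≢y , x≮y , y≮x) =
    (λ fx≡fy → x≢y (proj₁ emb _ _ fx≡fy))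
    , (λ fx<fy → x≮y (proj₂ (proj₂ emb _ _) fx<fy))
    , (λ fy<fx → y≮x (proj₂ (proj₂ emb _ _) fy<fx))

module BoxAugmentation {ℓ : Level} (𝔓 𝔓₁ 𝔓₂ : Poset ℓ)
                       (box : IsBoxAugmentation 𝔓 𝔓₁ 𝔓₂) where
  open Poset 𝔓₁ using () renaming (_<_ to _<₁_)
  open Poset 𝔓₂ using () renaming (_<_ to _<₂_)

  η : Poset.Carrier 𝔓₁ × Poset.Carrier 𝔓₂ → Poset.Carrier 𝔓
  η = proj₁ box

  row-embedding : ∀ d₂ → IsOrderEmbedding 𝔓₁ 𝔓 (λ e → η (e , d₂))
  row-embedding = proj₁ (proj₂ (proj₂ box))

  column-embedding : ∀ d₁ → IsOrderEmbedding 𝔓₂ 𝔓 (λ e → η (d₁ , e))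
  column-embedding = proj₂ (proj₂ (proj₂ box))

  corners-comparable : UpwardsLinear 𝔓 → ∀ {x₁ y₁ x₂ y₂} →
    x₁ <₁ y₁ → x₂ <₂ y₂ → ¬ Incomparable 𝔓 (η (x₁ , y₂)) (η (y₁ , x₂))
  corners-comparable ul {x₁} {x₂ = x₂} x₁<y₁ x₂<y₂ =
    ul (embedding-mono 𝔓₂ 𝔓 (column-embedding x₁) x₂<y₂)
       (embedding-mono 𝔓₁ 𝔓 (row-embedding x₂) x₁<y₁)

lemma3p14 : {ℓ : Level} (𝔓 𝔓₁ 𝔓₂ : Poset ℓ) →
    WellFounded 𝔓 → UpwardsLinear 𝔓 →
    WellFounded 𝔓₁ → UpwardsLinear 𝔓₁ →
    WellFounded 𝔓₂ → UpwardsLinear 𝔓₂ →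
    IsBoxAugmentation 𝔓 𝔓₁ 𝔓₂ →
    ¬ (HasBranchingNode 𝔓₁ × HasBranchingNode 𝔓₂)
lemma3p14 𝔓 𝔓₁ 𝔓₂ _ ul _ _ _ _ box
  ((a , b₁ , c₁ , b₁<a , c₁<a , b₁⊥c₁) , (a′ , b₂ , c₂ , b₂<a′ , c₂<a′ , b₂⊥c₂)) =
  corners-comparable ul b₁<a b₂<a′
    (cross-comparable⇒incomparable 𝔓 ul
      (embedding-incomparable 𝔓₁ 𝔓 (row-embedding a′) b₁⊥c₁)
      (embedding-incomparable 𝔓₂ 𝔓 (column-embedding a) b₂⊥c₂)
      (corners-comparable ul b₁<a c₂<a′)
      (corners-comparable ul c₁<a b₂<a′))
  where open BoxAugmentation 𝔓 𝔓₁ 𝔓₂ box
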